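{- Let $m\ge1$, $n_1,\dots,n_m$ positive integers, and $k_1<\dots<k_m$ positive integers with $k_1\le n_1$, $k_i<k_{i-1}+n_i$ for $1<i<m$, and $k_m\le k_{m-1}+n_m$ (the case $k_m=k_{m-1}+n_m$ encoding that level $m$ consists of dummies). Let $G=H_\exists(\mathbf n,\mathbf k)$. Then $G$ is a weighted majority game if and only if one of the following holds: (1) $m=1$; (2) $m=2$ and $k_2=k_1+1$; (3) $m=2$ and $n_2=k_2-k_1+1$; (4) $k_1=1$ and either $m=2$, or $m=3$ and the game $H_\exists((n_2,n_3),(k_2,k_3))$ falls under (2) or (3), i.e. $k_3=k_2+1$ or $n_3=k_3-k_2+1$; (5) $m\in\{2,3,4\}$, $k_m\ge k_{m-1}+n_m$, and the parameters $\mathbf n'=(n_1,\dots,n_{m-1})$, $\mathbf k'=(k_1,\dots,k_{m-1})$ of the $(m-1)$-level game $H_\exists(\mathbf n',\mathbf k')$ satisfy one of (1)–(4) (with $m-1$ in place of $m$).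
   Context: Submultisets of $\{1^{n_1},\dots,m^{n_m}\}$ are written $\{1^{\ell_1},\dots,m^{\ell_m}\}$ with $0\le\ell_i\le n_i$. The disjunctive hierarchical game $H_\exists(\mathbf n,\mathbf k)$, $\mathbf n=(n_1,\dots,n_m)$, $\mathbf k=(k_1,\dots,k_m)$, is the simple game on the multiset $\{1^{n_1},\dots,m^{n_m}\}$ in which $\{1^{\ell_1},\dots,m^{\ell_m}\}$ is winning iff there exists $i$ with $\ell_1+\dots+\ell_i\ge k_i$. A game on this multiset is a weighted majority game if there exist nonnegative weights $w_1,\dots,w_m$ and $q\ge0$ such that $\{1^{\ell_1},\dots,m^{\ell_m}\}$ is winning iff $\sum_i\ell_iw_i\ge q$.
   Formalization: The nonnegative weights $w_1,\dots,w_m$ and $q$ in the definition of a weighted majority game are taken in the rationals. -}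

module Defs where

open import Data.Nat as ℕ using (ℕ; zero; suc; _≤_; _<_; _∸_)
open import Data.Integer using (+_)
open import Data.Rational as ℚ using (ℚ; 0ℚ)
open import Data.Product using (Σ; _×_; ∃)
open import Data.Sum using (_⊎_)
open import Function.Bundles using (_⇔_)
open import Relation.Binary.PropositionalEquality using (_≡_)

-- Conventions: levels are indexed 1..m; a parameter vector (n₁,…,n_m) is
-- a function ℕ → ℕ of which only the values at 1..m matter.

toℚ : ℕ → ℚ
toℚ a = + a ℚ./ 1

-- ℓ describes a submultiset {1^ℓ₁,…,m^ℓ_m} of {1^n₁,…,m^n_m}
Submultiset : (m : ℕ) → (n : ℕ → ℕ) → (ℓ : ℕ → ℕ) → Set
Submultiset m n ℓ = ∀ i → 1 ≤ i → i ≤ m → ℓ i ≤ n i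

prefixSum : (ℕ → ℕ) → ℕ → ℕ
prefixSum ℓ zero    = 0
prefixSum ℓ (suc i) = prefixSum ℓ i ℕ.+ ℓ (suc i)

HExistsWins : (m : ℕ) → (k : ℕ → ℕ) → (ℓ : ℕ → ℕ) → Set
HExistsWins m k ℓ = ∃ λ i → 1 ≤ i × i ≤ m × k i ≤ prefixSum ℓ i

weightedSum : (m : ℕ) → (ℓ : ℕ → ℕ) → (w : ℕ → ℚ) → ℚ
weightedSum zero    ℓ w = 0ℚ
weightedSum (suc i) ℓ w = weightedSum i ℓ w ℚ.+ toℚ (ℓ (suc i)) ℚ.* w (suc i)

IsWeightedMajority : (m : ℕ) → (n : ℕ → ℕ) → (W : (ℕ → ℕ) → Set) → Set
IsWeightedMajority m n W =
  Σ (ℕ → ℚ) λ w → Σ ℚ λ q →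
    (∀ i → 1 ≤ i → i ≤ m → 0ℚ ℚ.≤ w i) × (0ℚ ℚ.≤ q) ×
    (∀ ℓ → Submultiset m n ℓ → (W ℓ ⇔ (q ℚ.≤ weightedSum m ℓ w)))

Admissible : (m : ℕ) → (n k : ℕ → ℕ) → Set
Admissible m n k =
  1 ≤ m ×
  (∀ i → 1 ≤ i → i ≤ m → 1 ≤ n i) ×
  (∀ i → 1 ≤ i → i ≤ m → 1 ≤ k i) ×
  (∀ i → 1 ≤ i → i < m → k i < k (suc i)) ×
  k 1 ≤ n 1 ×
  (∀ i → 1 < i → i < m → k i < k (i ∸ 1) ℕ.+ n i) ×
  (2 ≤ m → k m ≤ k (m ∸ 1) ℕ.+ n m)

Cond1-4 : (m : ℕ) → (n k : ℕ → ℕ) → Set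
Cond1-4 m n k =
  (m ≡ 1) ⊎
  (m ≡ 2 × k 2 ≡ k 1 ℕ.+ 1) ⊎
  (m ≡ 2 × n 2 ≡ (k 2 ∸ k 1) ℕ.+ 1) ⊎
  (k 1 ≡ 1 × (m ≡ 2 ⊎
     (m ≡ 3 × (k 3 ≡ k 2 ℕ.+ 1 ⊎ n 3 ≡ (k 3 ∸ k 2) ℕ.+ 1))))

Cond5 : (m : ℕ) → (n k : ℕ → ℕ) → Set
Cond5 m n k =
  (m ≡ 2 ⊎ m ≡ 3 ⊎ m ≡ 4) ×
  k (m ∸ 1) ℕ.+ n m ≤ k m ×
  Cond1-4 (m ∸ 1) n k

Cond1-5 : (m : ℕ) → (n k : ℕ → ℕ) → Set
Cond1-5 m n k = Cond1-4 m n k ⊎ Cond5 m n k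

module Submission where

-- A weighted game admits no trade: winning coalitions A, B and losing ones C, D with A + B = C + D,
-- since summing weights would give 2q ≤ w(A) + w(B) = w(C) + w(D) < 2q.  Without dummies and with
-- k₁ ≥ 2, (k₁, 0) + (k₁ − 2, k₂ − k₁ + 2) = (k₁ − 1, 2) + (k₁ − 1, k₂ − k₁) is such a trade on two
-- levels unless (2) or (3) holds, and a similar one rules out three levels.  When k₁ = 1 every player
-- of level 1 wins alone, so the game is weighted exactly when the game on levels 2, …, m is; this gives
-- (4).  A top level of dummies can be dropped, or added with weight 0, which gives (5).  Conversely,
-- in cases (2) and (3) the weights (c₁ + c₂, c₂) with (c₁, c₂) = (1, k₁), resp. (k₂ − k₁, 1), work.

open import Algebra.Bundles using (CommutativeMonoid)
open import Data.Empty using (⊥-elim)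
import Data.Integer as ℤ
import Data.Integer.Properties as ℤ
open import Data.List using (List; []; _∷_)
open import Data.List.Relation.Binary.Pointwise using (Pointwise; []; _∷_)
open import Data.Nat
open import Data.Nat.Coprimality as Coprimality using (1-coprimeTo)
open import Data.Nat.Properties
open import Data.Nat.Tactic.RingSolver using (solve-∀)
open import Data.Product using (_×_; _,_; ∃)
open import Data.Rational as ℚ using (ℚ; 0ℚ; 1ℚ; mkℚ)
import Data.Rational.Properties as ℚ
import Data.Rational.Unnormalised as ℚᵘ
import Data.Rational.Unnormalised.Properties as ℚᵘ
open import Data.Sum as Sum using (_⊎_; inj₁; inj₂)
open import Function.Base using (_∘_)
open import Function.Bundles using (_⇔_; mk⇔; Equivalence)
import Function.Properties.Equivalence as ⇔
open import Relation.Binary.PropositionalEquality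
open import Relation.Nullary using (¬_; Dec; yes; no)
open import Relation.Nullary.Decidable using (map′; _×-dec_; decidable-stable)

open import Algebra.Properties.CommutativeSemigroup
  (CommutativeMonoid.commutativeSemigroup ℚ.+-0-commutativeMonoid) using (interchange)

open import Defs

≤⇒∃+ : ∀ {a b} → a ≤ b → ∃ λ d → b ≡ a + d
≤⇒∃+ a≤b with d , a+d≡b ← m≤n⇒∃[o]m+o≡n a≤b = d , sym a+d≡b

<⇒∃+suc : ∀ {a b} → a < b → ∃ λ d → b ≡ a + suc d
<⇒∃+suc {a} a<b with d , b≡ ← ≤⇒∃+ a<b = d , trans b≡ (sym (+-suc a d))

∸-of-+ : ∀ a {b} d → b ≡ a + d → b ∸ a ≡ d
∸-of-+ a d refl = m+n∸m≡n a d

consecutive-gap : ∀ {κ κ′ ν} → κ < κ′ → κ′ < κ + ν → ∃ λ d → κ′ ≡ κ + suc d × 2 + d ≤ ν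
consecutive-gap {κ} {κ′} {ν} κ<κ′ κ′< with d , κ′≡ ← <⇒∃+suc κ<κ′ =
  d , κ′≡ , +-cancelˡ-≤ κ (2 + d) ν (subst (_≤ κ + ν) (trans (cong suc κ′≡) (sym (+-suc κ (suc d)))) κ′<)

combination-mono : ∀ c₁ c₂ {x₁ x₂ y₁ y₂} → x₁ ≤ y₁ → x₂ ≤ y₂ → c₁ * x₁ + c₂ * x₂ ≤ c₁ * y₁ + c₂ * y₂
combination-mono c₁ c₂ x₁≤y₁ x₂≤y₂ = +-mono-≤ (*-monoʳ-≤ c₁ x₁≤y₁) (*-monoʳ-≤ c₂ x₂≤y₂)

-- toℚ normalises through a gcd, which does not compute on variables; fromℕ is its normal form
fromℕ : ℕ → ℚ
fromℕ a = mkℚ (ℤ.+ a) 0 (Coprimality.sym (1-coprimeTo a))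

toℚ≡fromℕ : ∀ a → toℚ a ≡ fromℕ a
toℚ≡fromℕ a = ℚ.normalize-coprime _

toℚ-homo-+ : ∀ a b → toℚ (a + b) ≡ toℚ a ℚ.+ toℚ b
toℚ-homo-+ a b rewrite toℚ≡fromℕ a | toℚ≡fromℕ b | toℚ≡fromℕ (a + b) =
  ℚ.toℚᵘ-injective (ℚᵘ.≃-trans
    (ℚᵘ.*≡* (cong (ℤ._* ℤ.+ 1) (trans (ℤ.pos-+ a b)
      (sym (cong₂ ℤ._+_ (ℤ.*-identityʳ (ℤ.+ a)) (ℤ.*-identityʳ (ℤ.+ b)))))))
    (ℚᵘ.≃-sym (ℚ.toℚᵘ-homo-+ (fromℕ a) (fromℕ b))))

toℚ-homo-* : ∀ a b → toℚ (a * b) ≡ toℚ a ℚ.* toℚ b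
toℚ-homo-* a b rewrite toℚ≡fromℕ a | toℚ≡fromℕ b | toℚ≡fromℕ (a * b) =
  ℚ.toℚᵘ-injective (ℚᵘ.≃-trans
    (ℚᵘ.*≡* (cong (ℤ._* ℤ.+ 1) (ℤ.pos-* a b)))
    (ℚᵘ.≃-sym (ℚ.toℚᵘ-homo-* (fromℕ a) (fromℕ b))))

toℚ-mono-≤ : ∀ {a b} → a ≤ b → toℚ a ℚ.≤ toℚ b
toℚ-mono-≤ {a} {b} a≤b rewrite toℚ≡fromℕ a | toℚ≡fromℕ b =
  ℚ.*≤* (ℤ.*-monoʳ-≤-nonNeg (ℤ.+ 1) (ℤ.+≤+ a≤b))

toℚ-cancel-≤ : ∀ {a b} → toℚ a ℚ.≤ toℚ b → a ≤ b
toℚ-cancel-≤ {a} {b} le rewrite toℚ≡fromℕ a | toℚ≡fromℕ b with ℚ.*≤* le′ ← le =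
  ℤ.drop‿+≤+ (subst₂ ℤ._≤_ (ℤ.*-identityʳ (ℤ.+ a)) (ℤ.*-identityʳ (ℤ.+ b)) le′)

toℚ-nonNeg : ∀ a → 0ℚ ℚ.≤ toℚ a
toℚ-nonNeg a = toℚ-mono-≤ (z≤n {a})

≤-multiple+ : ∀ x {q s} → 0ℚ ℚ.≤ q → 0ℚ ℚ.≤ s → q ℚ.≤ toℚ (suc x) ℚ.* q ℚ.+ s
≤-multiple+ x {q} {s} q≥0 s≥0 = begin
  q                           ≡⟨ ℚ.*-identityˡ q ⟨
  1ℚ ℚ.* q                    ≤⟨ ℚ.*-monoʳ-≤-nonNeg q {{ℚ.nonNegative q≥0}} (toℚ-mono-≤ (s≤s (z≤n {x}))) ⟩
  toℚ (suc x) ℚ.* q           ≡⟨ ℚ.+-identityʳ _ ⟨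
  toℚ (suc x) ℚ.* q ℚ.+ 0ℚ    ≤⟨ ℚ.+-monoʳ-≤ (toℚ (suc x) ℚ.* q) s≥0 ⟩
  toℚ (suc x) ℚ.* q ℚ.+ s     ∎
  where open ℚ.≤-Reasoning

weightedSumℕ : ℕ → (ℕ → ℕ) → (ℕ → ℕ) → ℕ
weightedSumℕ zero    ℓ w = 0
weightedSumℕ (suc i) ℓ w = weightedSumℕ i ℓ w + ℓ (suc i) * w (suc i)

weightedSum-toℚ : ∀ m ℓ w → weightedSum m ℓ (toℚ ∘ w) ≡ toℚ (weightedSumℕ m ℓ w)
weightedSum-toℚ zero    ℓ w = refl
weightedSum-toℚ (suc m) ℓ w = trans
  (cong₂ ℚ._+_ (weightedSum-toℚ m ℓ w) (sym (toℚ-homo-* (ℓ (suc m)) (w (suc m)))))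
  (sym (toℚ-homo-+ (weightedSumℕ m ℓ w) (ℓ (suc m) * w (suc m))))

weightedSum-cong : ∀ m {ℓ ℓ′ w w′} →
  (∀ i → 1 ≤ i → i ≤ m → ℓ i ≡ ℓ′ i) → (∀ i → 1 ≤ i → i ≤ m → w i ≡ w′ i) →
  weightedSum m ℓ w ≡ weightedSum m ℓ′ w′
weightedSum-cong zero    _ _ = refl
weightedSum-cong (suc m) ℓ≗ℓ′ w≗w′ = cong₂ ℚ._+_
  (weightedSum-cong m (λ i 1≤i i≤m → ℓ≗ℓ′ i 1≤i (m≤n⇒m≤1+n i≤m))
                      (λ i 1≤i i≤m → w≗w′ i 1≤i (m≤n⇒m≤1+n i≤m)))
  (cong₂ (λ x y → toℚ x ℚ.* y) (ℓ≗ℓ′ (suc m) (s≤s z≤n) ≤-refl) (w≗w′ (suc m) (s≤s z≤n) ≤-refl))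

weightedSum-+ : ∀ m ℓ ℓ′ w → weightedSum m (λ i → ℓ i + ℓ′ i) w ≡ weightedSum m ℓ w ℚ.+ weightedSum m ℓ′ w
weightedSum-+ zero    ℓ ℓ′ w = refl
weightedSum-+ (suc m) ℓ ℓ′ w = begin
  weightedSum m (λ i → ℓ i + ℓ′ i) w ℚ.+ toℚ (ℓ x + ℓ′ x) ℚ.* w x
    ≡⟨ cong₂ ℚ._+_ (weightedSum-+ m ℓ ℓ′ w)
         (trans (cong (ℚ._* w x) (toℚ-homo-+ (ℓ x) (ℓ′ x))) (ℚ.*-distribʳ-+ (w x) (toℚ (ℓ x)) (toℚ (ℓ′ x)))) ⟩
  (weightedSum m ℓ w ℚ.+ weightedSum m ℓ′ w) ℚ.+ (toℚ (ℓ x) ℚ.* w x ℚ.+ toℚ (ℓ′ x) ℚ.* w x)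
    ≡⟨ interchange (weightedSum m ℓ w) (weightedSum m ℓ′ w) (toℚ (ℓ x) ℚ.* w x) (toℚ (ℓ′ x) ℚ.* w x) ⟩
  (weightedSum m ℓ w ℚ.+ toℚ (ℓ x) ℚ.* w x) ℚ.+ (weightedSum m ℓ′ w ℚ.+ toℚ (ℓ′ x) ℚ.* w x) ∎
  where
  open ≡-Reasoning
  x = suc m

weightedSum-nonNeg : ∀ m ℓ {w} → (∀ i → 1 ≤ i → i ≤ m → 0ℚ ℚ.≤ w i) → 0ℚ ℚ.≤ weightedSum m ℓ w
weightedSum-nonNeg zero    _ _ = ℚ.≤-refl
weightedSum-nonNeg (suc m) ℓ {w} w≥0 = ℚ.+-mono-≤
  (weightedSum-nonNeg m ℓ (λ i 1≤i i≤m → w≥0 i 1≤i (m≤n⇒m≤1+n i≤m)))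
  (ℚ.nonNegative⁻¹ _ {{ℚ.nonNeg*nonNeg⇒nonNeg (toℚ (ℓ (suc m))) {{ℚ.nonNegative (toℚ-nonNeg (ℓ (suc m)))}}
                                               (w (suc m)) {{ℚ.nonNegative (w≥0 (suc m) (s≤s z≤n) ≤-refl)}}}})

_IsTailOf_ : {A : Set} → (ℕ → A) → (ℕ → A) → Set
ℓ′ IsTailOf ℓ = ∀ i → ℓ′ (suc i) ≡ ℓ (suc (suc i))

-- the value at the unused index 0 is junk
_◃_ : {A : Set} → A → (ℕ → A) → ℕ → A
(x ◃ f) (suc (suc i)) = f (suc i)
(x ◃ f) _             = x

prefixSum-tail : ∀ {ℓ ℓ′} → ℓ′ IsTailOf ℓ → ∀ i → prefixSum ℓ (suc i) ≡ ℓ 1 + prefixSum ℓ′ i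
prefixSum-tail {ℓ} _ zero    = +-comm 0 (ℓ 1)
prefixSum-tail {ℓ} {ℓ′} t (suc i) = begin
  prefixSum ℓ (suc i) + ℓ (suc (suc i))  ≡⟨ cong₂ _+_ (prefixSum-tail t i) (sym (t i)) ⟩
  (ℓ 1 + prefixSum ℓ′ i) + ℓ′ (suc i)    ≡⟨ +-assoc (ℓ 1) _ _ ⟩
  ℓ 1 + prefixSum ℓ′ (suc i)             ∎
  where open ≡-Reasoning

weightedSum-tail : ∀ {ℓ ℓ′ w w′} → ℓ′ IsTailOf ℓ → w′ IsTailOf w → ∀ m →
  weightedSum (suc m) ℓ w ≡ toℚ (ℓ 1) ℚ.* w 1 ℚ.+ weightedSum m ℓ′ w′
weightedSum-tail {ℓ} {w = w} _ _ zero =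
  trans (ℚ.+-identityˡ (toℚ (ℓ 1) ℚ.* w 1)) (sym (ℚ.+-identityʳ (toℚ (ℓ 1) ℚ.* w 1)))
weightedSum-tail {ℓ} {ℓ′} {w} {w′} t u (suc m) = begin
  weightedSum (suc m) ℓ w ℚ.+ toℚ (ℓ (suc (suc m))) ℚ.* w (suc (suc m))
    ≡⟨ cong₂ ℚ._+_ (weightedSum-tail t u m) (cong₂ (λ x y → toℚ x ℚ.* y) (sym (t m)) (sym (u m))) ⟩
  (toℚ (ℓ 1) ℚ.* w 1 ℚ.+ weightedSum m ℓ′ w′) ℚ.+ toℚ (ℓ′ (suc m)) ℚ.* w′ (suc m)
    ≡⟨ ℚ.+-assoc (toℚ (ℓ 1) ℚ.* w 1) _ _ ⟩
  toℚ (ℓ 1) ℚ.* w 1 ℚ.+ weightedSum (suc m) ℓ′ w′ ∎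
  where open ≡-Reasoning

prefixSum-mono : ∀ j {ℓ ℓ′} → Submultiset j ℓ′ ℓ → prefixSum ℓ j ≤ prefixSum ℓ′ j
prefixSum-mono zero    ℓ⊆ℓ′ = z≤n
prefixSum-mono (suc j) ℓ⊆ℓ′ = +-mono-≤
  (prefixSum-mono j (λ i 1≤i i≤j → ℓ⊆ℓ′ i 1≤i (m≤n⇒m≤1+n i≤j)))
  (ℓ⊆ℓ′ (suc j) (s≤s z≤n) ≤-refl)

profile : List ℕ → ℕ → ℕ
profile (x ∷ xs) (suc zero)    = x
profile (x ∷ xs) (suc (suc i)) = profile xs (suc i)
profile _        _             = 0

profile-⊆ : ∀ {m xs ys} → Pointwise _≤_ xs ys → Submultiset m (profile ys) (profile xs)
profile-⊆ xs≤ys i _ _ = mono xs≤ys i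
  where
  mono : ∀ {xs ys} → Pointwise _≤_ xs ys → ∀ i → profile xs i ≤ profile ys i
  mono []              _             = z≤n
  mono (_   ∷ _)     zero          = z≤n
  mono (x≤y ∷ _)     (suc zero)    = x≤y
  mono (_   ∷ xs≤ys) (suc (suc i)) = mono xs≤ys (suc i)

Submultiset-trans : ∀ {m ℓ ℓ′ ℓ″} → Submultiset m ℓ″ ℓ′ → Submultiset m ℓ′ ℓ → Submultiset m ℓ″ ℓ
Submultiset-trans ℓ′⊆ℓ″ ℓ⊆ℓ′ i 1≤i i≤m = ≤-trans (ℓ⊆ℓ′ i 1≤i i≤m) (ℓ′⊆ℓ″ i 1≤i i≤m)

levels₂ : {P : ℕ → Set} → P 1 → P 2 → ∀ i → 1 ≤ i → i ≤ 2 → P i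
levels₂ p₁ p₂ zero                ()  _
levels₂ p₁ p₂ (suc zero)          _   _ = p₁
levels₂ p₁ p₂ (suc (suc zero))    _   _ = p₂
levels₂ p₁ p₂ (suc (suc (suc _))) _   (s≤s (s≤s ()))

levels₃ : {P : ℕ → Set} → P 1 → P 2 → P 3 → ∀ i → 1 ≤ i → i ≤ 3 → P i
levels₃ p₁ p₂ p₃ zero                      ()  _
levels₃ p₁ p₂ p₃ (suc zero)                _   _ = p₁
levels₃ p₁ p₂ p₃ (suc (suc zero))          _   _ = p₂
levels₃ p₁ p₂ p₃ (suc (suc (suc zero)))    _   _ = p₃
levels₃ p₁ p₂ p₃ (suc (suc (suc (suc _)))) _   (s≤s (s≤s (s≤s ())))

Losing : ℕ → (ℕ → ℕ) → (ℕ → ℕ) → Set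
Losing m k ℓ = ∀ i → 1 ≤ i → i ≤ m → prefixSum ℓ i < k i

losing⇒¬wins : ∀ {m k ℓ} → Losing m k ℓ → ¬ HExistsWins m k ℓ
losing⇒¬wins L (i , 1≤i , i≤m , kᵢ≤) = <⇒≱ (L i 1≤i i≤m) kᵢ≤

¬wins⇒losing : ∀ {m k ℓ} → ¬ HExistsWins m k ℓ → Losing m k ℓ
¬wins⇒losing {k = k} {ℓ} ¬wins i 1≤i i≤m with k i ≤? prefixSum ℓ i
... | yes kᵢ≤ = ⊥-elim (¬wins (i , 1≤i , i≤m , kᵢ≤))
... | no  kᵢ≰ = ≰⇒> kᵢ≰

wins? : ∀ m k ℓ → Dec (HExistsWins m k ℓ)
wins? m k ℓ = map′
  (λ (i , i<1+m , 1≤i , kᵢ≤) → i , 1≤i , ≤-pred i<1+m , kᵢ≤)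
  (λ (i , 1≤i , i≤m , kᵢ≤) → i , s≤s i≤m , 1≤i , kᵢ≤)
  (anyUpTo? (λ i → 1 ≤? i ×-dec k i ≤? prefixSum ℓ i) (suc m))

wins⇔threshold : ∀ m k ℓ {q s} → (HExistsWins m k ℓ → q ≤ s) → (Losing m k ℓ → s < q) →
  HExistsWins m k ℓ ⇔ q ≤ s
wins⇔threshold m k ℓ win lose =
  mk⇔ win (λ q≤s → decidable-stable (wins? m k ℓ) λ ¬wins → <⇒≱ (lose (¬wins⇒losing ¬wins)) q≤s)

wins-mono : ∀ m k {ℓ ℓ′} → Submultiset m ℓ′ ℓ → HExistsWins m k ℓ → HExistsWins m k ℓ′
wins-mono m k ℓ⊆ℓ′ (i , 1≤i , i≤m , kᵢ≤) =
  i , 1≤i , i≤m , ≤-trans kᵢ≤ (prefixSum-mono i (λ j 1≤j j≤i → ℓ⊆ℓ′ j 1≤j (≤-trans j≤i i≤m)))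

wins-extend : ∀ m k {ℓ} → 1 ≤ m → (k (suc m) ≤ prefixSum ℓ (suc m) → k m ≤ prefixSum ℓ m) →
  HExistsWins (suc m) k ℓ ⇔ HExistsWins m k ℓ
wins-extend m k 1≤m top = mk⇔ to λ (i , 1≤i , i≤m , kᵢ≤) → i , 1≤i , m≤n⇒m≤1+n i≤m , kᵢ≤
  where
  to : HExistsWins (suc m) k _ → HExistsWins m k _
  to (i , 1≤i , i≤1+m , kᵢ≤) with m≤n⇒m<n∨m≡n i≤1+m
  ... | inj₁ i<1+m = i , 1≤i , ≤-pred i<1+m , kᵢ≤
  ... | inj₂ refl  = m , 1≤m , ≤-refl , top kᵢ≤

wins-tail : ∀ m k {ℓ ℓ′} → 1 ≤ k 1 → ℓ 1 ≡ 0 → ℓ′ IsTailOf ℓ →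
  HExistsWins (suc m) k ℓ ⇔ HExistsWins m (k ∘ suc) ℓ′
wins-tail m k {ℓ} {ℓ′} k₁≥1 ℓ₁≡0 t = mk⇔ to from
  where
  prefixSum≡ : ∀ i → prefixSum ℓ (suc i) ≡ prefixSum ℓ′ i
  prefixSum≡ i = trans (prefixSum-tail t i) (cong (_+ prefixSum ℓ′ i) ℓ₁≡0)
  to : HExistsWins (suc m) k ℓ → HExistsWins m (k ∘ suc) ℓ′
  to (suc zero    , _ , _         , k₁≤) = ⊥-elim (<⇒≱ k₁≥1 (subst (k 1 ≤_) (prefixSum≡ 0) k₁≤))
  to (suc (suc i) , _ , s≤s i<1+m , kᵢ≤) =
    suc i , s≤s z≤n , i<1+m , subst (k (suc (suc i)) ≤_) (prefixSum≡ (suc i)) kᵢ≤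
  from : HExistsWins m (k ∘ suc) ℓ′ → HExistsWins (suc m) k ℓ
  from (i , 1≤i , i≤m , kᵢ≤) = suc i , s≤s z≤n , s≤s i≤m , subst (k (suc i) ≤_) (sym (prefixSum≡ i)) kᵢ≤

ℕ-weights⇒weighted : ∀ m n k (w : ℕ → ℕ) q →
  (∀ ℓ → Submultiset m n ℓ → HExistsWins m k ℓ → q ≤ weightedSumℕ m ℓ w) →
  (∀ ℓ → Submultiset m n ℓ → Losing m k ℓ → weightedSumℕ m ℓ w < q) →
  IsWeightedMajority m n (HExistsWins m k)
ℕ-weights⇒weighted m n k w q win lose =
  toℚ ∘ w , toℚ q , (λ i _ _ → toℚ-nonNeg (w i)) , toℚ-nonNeg q , λ ℓ ℓ⊆n →
    subst (λ s → HExistsWins m k ℓ ⇔ toℚ q ℚ.≤ s) (sym (weightedSum-toℚ m ℓ w))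
      (⇔.trans (wins⇔threshold m k ℓ (win ℓ ℓ⊆n) (lose ℓ ℓ⊆n)) (mk⇔ toℚ-mono-≤ toℚ-cancel-≤))

record Trade (m : ℕ) (n k : ℕ → ℕ) : Set where
  field
    A B C D  : ℕ → ℕ
    A⊆n      : Submultiset m n A
    B⊆n      : Submultiset m n B
    C⊆n      : Submultiset m n C
    D⊆n      : Submultiset m n D
    A-wins   : HExistsWins m k A
    B-wins   : HExistsWins m k B
    C-loses  : ¬ HExistsWins m k C
    D-loses  : ¬ HExistsWins m k D
    balanced : ∀ i → 1 ≤ i → i ≤ m → A i + B i ≡ C i + D i

trade⇒¬weighted : ∀ {m n k} → Trade m n k → ¬ IsWeightedMajority m n (HExistsWins m k)
trade⇒¬weighted {m} {n} {k} t (w , q , _ , _ , wins⇔) = ℚ.<-irrefl refl (begin-strict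
  q ℚ.+ q                                   ≤⟨ ℚ.+-mono-≤ (above A A⊆n A-wins) (above B B⊆n B-wins) ⟩
  weightedSum m A w ℚ.+ weightedSum m B w   ≡⟨ weightedSum-+ m A B w ⟨
  weightedSum m (λ i → A i + B i) w         ≡⟨ weightedSum-cong m balanced (λ _ _ _ → refl) ⟩
  weightedSum m (λ i → C i + D i) w         ≡⟨ weightedSum-+ m C D w ⟩
  weightedSum m C w ℚ.+ weightedSum m D w   <⟨ ℚ.+-mono-< (below C C⊆n C-loses) (below D D⊆n D-loses) ⟩
  q ℚ.+ q                                   ∎)
  where
  open Trade t
  open ℚ.≤-Reasoning
  above : ∀ ℓ → Submultiset m n ℓ → HExistsWins m k ℓ → q ℚ.≤ weightedSum m ℓ w
  above ℓ ℓ⊆n = Equivalence.to (wins⇔ ℓ ℓ⊆n)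
  below : ∀ ℓ → Submultiset m n ℓ → ¬ HExistsWins m k ℓ → weightedSum m ℓ w ℚ.< q
  below ℓ ℓ⊆n loses = ℚ.≰⇒> (loses ∘ Equivalence.from (wins⇔ ℓ ℓ⊆n))

truncateAbove : {A : Set} → A → ℕ → (ℕ → A) → ℕ → A
truncateAbove z m f i with i ≤? m
... | yes _ = f i
... | no  _ = z

truncateAbove-≤ : ∀ {A : Set} {z : A} {m f i} → i ≤ m → truncateAbove z m f i ≡ f i
truncateAbove-≤ {m = m} {i = i} i≤m with i ≤? m
... | yes _   = refl
... | no  i≰m = ⊥-elim (i≰m i≤m)

truncateAbove-suc : ∀ {A : Set} {z : A} m f → truncateAbove z m f (suc m) ≡ z
truncateAbove-suc m f with suc m ≤? m
... | yes 1+m≤m = ⊥-elim (<-irrefl refl 1+m≤m)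
... | no  _     = refl

weighted⇒init-weighted : ∀ m n k → 1 ≤ m → k m ≤ k (suc m) →
  IsWeightedMajority (suc m) n (HExistsWins (suc m) k) → IsWeightedMajority m n (HExistsWins m k)
weighted⇒init-weighted m n k 1≤m kₘ≤ (w , q , w≥0 , q≥0 , wins⇔) =
  w , q , (λ i 1≤i i≤m → w≥0 i 1≤i (m≤n⇒m≤1+n i≤m)) , q≥0 , λ ℓ ℓ⊆n →
    subst (λ s → HExistsWins m k ℓ ⇔ q ℚ.≤ s) (sum≡ ℓ)
      (⇔.trans (wins⇔wins⁰ ℓ) (wins⇔ (ℓ⁰ ℓ) (ℓ⁰⊆n ℓ ℓ⊆n)))
  where
  ℓ⁰ : (ℕ → ℕ) → ℕ → ℕ
  ℓ⁰ = truncateAbove 0 m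
  ℓ⁰≗ℓ : ∀ ℓ i → 1 ≤ i → i ≤ m → ℓ⁰ ℓ i ≡ ℓ i
  ℓ⁰≗ℓ ℓ i _ i≤m = truncateAbove-≤ i≤m
  ℓ⁰⊆n : ∀ ℓ → Submultiset m n ℓ → Submultiset (suc m) n (ℓ⁰ ℓ)
  ℓ⁰⊆n ℓ ℓ⊆n i 1≤i i≤1+m with m≤n⇒m<n∨m≡n i≤1+m
  ... | inj₁ i<1+m = subst (_≤ n i) (sym (ℓ⁰≗ℓ ℓ i 1≤i (≤-pred i<1+m))) (ℓ⊆n i 1≤i (≤-pred i<1+m))
  ... | inj₂ refl  = subst (_≤ n i) (sym (truncateAbove-suc m ℓ)) z≤n
  wins⇔wins⁰ : ∀ ℓ → HExistsWins m k ℓ ⇔ HExistsWins (suc m) k (ℓ⁰ ℓ)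
  wins⇔wins⁰ ℓ = ⇔.trans
    (mk⇔ (wins-mono m k λ i 1≤i i≤m → ≤-reflexive (sym (ℓ⁰≗ℓ ℓ i 1≤i i≤m)))
         (wins-mono m k λ i 1≤i i≤m → ≤-reflexive (ℓ⁰≗ℓ ℓ i 1≤i i≤m)))
    (⇔.sym (wins-extend m k 1≤m λ k≤ → ≤-trans kₘ≤ (≤-trans k≤
      (≤-reflexive (trans (cong (prefixSum (ℓ⁰ ℓ) m +_) (truncateAbove-suc m ℓ)) (+-identityʳ _))))))
  sum≡ : ∀ ℓ → weightedSum (suc m) (ℓ⁰ ℓ) w ≡ weightedSum m ℓ w
  sum≡ ℓ = begin
    weightedSum m (ℓ⁰ ℓ) w ℚ.+ toℚ (ℓ⁰ ℓ (suc m)) ℚ.* w (suc m)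
      ≡⟨ cong₂ (λ s x → s ℚ.+ toℚ x ℚ.* w (suc m))
           (weightedSum-cong m (ℓ⁰≗ℓ ℓ) (λ _ _ _ → refl)) (truncateAbove-suc m ℓ) ⟩
    weightedSum m ℓ w ℚ.+ 0ℚ ℚ.* w (suc m)
      ≡⟨ cong (weightedSum m ℓ w ℚ.+_) (ℚ.*-zeroˡ (w (suc m))) ⟩
    weightedSum m ℓ w ℚ.+ 0ℚ
      ≡⟨ ℚ.+-identityʳ (weightedSum m ℓ w) ⟩
    weightedSum m ℓ w ∎
    where open ≡-Reasoning

init-weighted⇒weighted : ∀ m n k → 1 ≤ m → k m + n (suc m) ≤ k (suc m) →
  IsWeightedMajority m n (HExistsWins m k) → IsWeightedMajority (suc m) n (HExistsWins (suc m) k)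
init-weighted⇒weighted m n k 1≤m dummies (w , q , w≥0 , q≥0 , wins⇔) =
  w⁰ , q , w⁰≥0 , q≥0 , λ ℓ ℓ⊆n →
    subst (λ s → HExistsWins (suc m) k ℓ ⇔ q ℚ.≤ s) (sym (sum≡ ℓ))
      (⇔.trans (wins-extend m k 1≤m (top ℓ ℓ⊆n)) (wins⇔ ℓ λ i 1≤i i≤m → ℓ⊆n i 1≤i (m≤n⇒m≤1+n i≤m)))
  where
  w⁰ : ℕ → ℚ
  w⁰ = truncateAbove 0ℚ m w
  w⁰≥0 : ∀ i → 1 ≤ i → i ≤ suc m → 0ℚ ℚ.≤ w⁰ i
  w⁰≥0 i 1≤i i≤1+m with m≤n⇒m<n∨m≡n i≤1+m
  ... | inj₁ i<1+m = subst (0ℚ ℚ.≤_) (sym (truncateAbove-≤ (≤-pred i<1+m))) (w≥0 i 1≤i (≤-pred i<1+m))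
  ... | inj₂ refl  = subst (0ℚ ℚ.≤_) (sym (truncateAbove-suc m w)) ℚ.≤-refl
  top : ∀ ℓ → Submultiset (suc m) n ℓ → k (suc m) ≤ prefixSum ℓ (suc m) → k m ≤ prefixSum ℓ m
  top ℓ ℓ⊆n k≤ = +-cancelʳ-≤ (n (suc m)) (k m) (prefixSum ℓ m)
    (≤-trans dummies (≤-trans k≤ (+-monoʳ-≤ (prefixSum ℓ m) (ℓ⊆n (suc m) (s≤s z≤n) ≤-refl))))
  sum≡ : ∀ ℓ → weightedSum (suc m) ℓ w⁰ ≡ weightedSum m ℓ w
  sum≡ ℓ = begin
    weightedSum m ℓ w⁰ ℚ.+ toℚ (ℓ (suc m)) ℚ.* w⁰ (suc m)
      ≡⟨ cong₂ (λ s x → s ℚ.+ toℚ (ℓ (suc m)) ℚ.* x)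
           (weightedSum-cong m (λ _ _ _ → refl) (λ _ _ i≤m → truncateAbove-≤ i≤m)) (truncateAbove-suc m w) ⟩
    weightedSum m ℓ w ℚ.+ toℚ (ℓ (suc m)) ℚ.* 0ℚ
      ≡⟨ cong (weightedSum m ℓ w ℚ.+_) (ℚ.*-zeroʳ (toℚ (ℓ (suc m)))) ⟩
    weightedSum m ℓ w ℚ.+ 0ℚ
      ≡⟨ ℚ.+-identityʳ (weightedSum m ℓ w) ⟩
    weightedSum m ℓ w ∎
    where open ≡-Reasoning

weighted⇒tail-weighted : ∀ m n k → 1 ≤ k 1 →
  IsWeightedMajority (suc m) n (HExistsWins (suc m) k) → IsWeightedMajority m (n ∘ suc) (HExistsWins m (k ∘ suc))
weighted⇒tail-weighted m n k k₁≥1 (w , q , w≥0 , q≥0 , wins⇔) =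
  w ∘ suc , q , (λ i _ i≤m → w≥0 (suc i) (s≤s z≤n) (s≤s i≤m)) , q≥0 , λ ℓ′ ℓ′⊆n →
    subst (λ s → HExistsWins m (k ∘ suc) ℓ′ ⇔ q ℚ.≤ s) (sum≡ ℓ′)
      (⇔.trans (⇔.sym (wins-tail m k k₁≥1 refl (λ _ → refl))) (wins⇔ (0 ◃ ℓ′) (⊆n ℓ′ ℓ′⊆n)))
  where
  ⊆n : ∀ ℓ′ → Submultiset m (n ∘ suc) ℓ′ → Submultiset (suc m) n (0 ◃ ℓ′)
  ⊆n ℓ′ ℓ′⊆n (suc zero)    _ _           = z≤n
  ⊆n ℓ′ ℓ′⊆n (suc (suc i)) _ (s≤s i<1+m) = ℓ′⊆n (suc i) (s≤s z≤n) i<1+m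
  sum≡ : ∀ ℓ′ → weightedSum (suc m) (0 ◃ ℓ′) w ≡ weightedSum m ℓ′ (w ∘ suc)
  sum≡ ℓ′ = begin
    weightedSum (suc m) (0 ◃ ℓ′) w             ≡⟨ weightedSum-tail (λ _ → refl) (λ _ → refl) m ⟩
    0ℚ ℚ.* w 1 ℚ.+ weightedSum m ℓ′ (w ∘ suc)  ≡⟨ cong (ℚ._+ weightedSum m ℓ′ (w ∘ suc)) (ℚ.*-zeroˡ (w 1)) ⟩
    0ℚ ℚ.+ weightedSum m ℓ′ (w ∘ suc)          ≡⟨ ℚ.+-identityˡ _ ⟩
    weightedSum m ℓ′ (w ∘ suc)                 ∎
    where open ≡-Reasoning

-- level 1 gets weight q, so each of its players reaches the quota alone
tail-weighted⇒weighted : ∀ m n k → k 1 ≡ 1 →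
  IsWeightedMajority m (n ∘ suc) (HExistsWins m (k ∘ suc)) → IsWeightedMajority (suc m) n (HExistsWins (suc m) k)
tail-weighted⇒weighted m n k k₁≡1 (w′ , q , w′≥0 , q≥0 , wins′⇔) = q ◃ w′ , q , w≥0 , q≥0 , wins⇔
  where
  w≥0 : ∀ i → 1 ≤ i → i ≤ suc m → 0ℚ ℚ.≤ (q ◃ w′) i
  w≥0 (suc zero)    _ _           = q≥0
  w≥0 (suc (suc i)) _ (s≤s i<1+m) = w′≥0 (suc i) (s≤s z≤n) i<1+m
  sum≡ : ∀ ℓ → weightedSum (suc m) ℓ (q ◃ w′) ≡ toℚ (ℓ 1) ℚ.* q ℚ.+ weightedSum m (ℓ ∘ suc) w′
  sum≡ ℓ = weightedSum-tail (λ _ → refl) (λ _ → refl) m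
  wins⇔ : ∀ ℓ → Submultiset (suc m) n ℓ → HExistsWins (suc m) k ℓ ⇔ q ℚ.≤ weightedSum (suc m) ℓ (q ◃ w′)
  wins⇔ ℓ ℓ⊆n with ℓ 1 in ℓ₁≡
  ... | zero = subst (λ s → HExistsWins (suc m) k ℓ ⇔ q ℚ.≤ s) (sym sum≡′)
    (⇔.trans (wins-tail m k (≤-reflexive (sym k₁≡1)) ℓ₁≡ (λ _ → refl))
             (wins′⇔ (ℓ ∘ suc) λ i _ i≤m → ℓ⊆n (suc i) (s≤s z≤n) (s≤s i≤m)))
    where
    open ≡-Reasoning
    sum≡′ : weightedSum (suc m) ℓ (q ◃ w′) ≡ weightedSum m (ℓ ∘ suc) w′
    sum≡′ = begin
      weightedSum (suc m) ℓ (q ◃ w′)                  ≡⟨ sum≡ ℓ ⟩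
      toℚ (ℓ 1) ℚ.* q ℚ.+ weightedSum m (ℓ ∘ suc) w′  ≡⟨ cong (λ x → toℚ x ℚ.* q ℚ.+ weightedSum m (ℓ ∘ suc) w′) ℓ₁≡ ⟩
      0ℚ ℚ.* q ℚ.+ weightedSum m (ℓ ∘ suc) w′         ≡⟨ cong (ℚ._+ _) (ℚ.*-zeroˡ q) ⟩
      0ℚ ℚ.+ weightedSum m (ℓ ∘ suc) w′               ≡⟨ ℚ.+-identityˡ _ ⟩
      weightedSum m (ℓ ∘ suc) w′                      ∎
  ... | suc x = mk⇔ (λ _ → q≤) (λ _ → 1 , ≤-refl , s≤s z≤n , k₁≤ℓ₁)
    where
    k₁≤ℓ₁ : k 1 ≤ ℓ 1
    k₁≤ℓ₁ = subst₂ _≤_ (sym k₁≡1) (sym ℓ₁≡) (s≤s z≤n)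
    q≤ : q ℚ.≤ weightedSum (suc m) ℓ (q ◃ w′)
    q≤ = subst (q ℚ.≤_) (trans (cong (λ y → toℚ y ℚ.* q ℚ.+ weightedSum m (ℓ ∘ suc) w′) (sym ℓ₁≡)) (sym (sum≡ ℓ)))
           (≤-multiple+ x q≥0 (weightedSum-nonNeg m (ℓ ∘ suc) w′≥0))

weighted-oneLevel : ∀ n k → IsWeightedMajority 1 n (HExistsWins 1 k)
weighted-oneLevel n k = ℕ-weights⇒weighted 1 n k (λ _ → 1) (k 1) win lose
  where
  win : ∀ ℓ → Submultiset 1 n ℓ → HExistsWins 1 k ℓ → k 1 ≤ weightedSumℕ 1 ℓ (λ _ → 1)
  win ℓ _ (suc zero    , _ , _       , k₁≤) = ≤-trans k₁≤ (≤-reflexive (sym (*-identityʳ (ℓ 1))))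
  win ℓ _ (suc (suc _) , _ , s≤s () , _)
  lose : ∀ ℓ → Submultiset 1 n ℓ → Losing 1 k ℓ → weightedSumℕ 1 ℓ (λ _ → 1) < k 1
  lose ℓ _ L = subst (_< k 1) (sym (*-identityʳ (ℓ 1))) (L 1 ≤-refl ≤-refl)

wins₂-cases : ∀ {k ℓ} → HExistsWins 2 k ℓ → k 1 ≤ prefixSum ℓ 1 ⊎ k 2 ≤ prefixSum ℓ 2
wins₂-cases (suc zero          , _ , _                , k₁≤) = inj₁ k₁≤
wins₂-cases (suc (suc zero)    , _ , _                , k₂≤) = inj₂ k₂≤
wins₂-cases (suc (suc (suc _)) , _ , s≤s (s≤s ()) , _)

-- Weights (c₁ + c₂, c₂) value a coalition at c₁ P₁ + c₂ P₂ (Pᵢ its prefix sums), which is at most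
-- c₁ a₁ + c₂ a₂ when it loses.
prefixWeights₂⇒weighted : ∀ n k c₁ c₂ a₁ a₂ → k 1 ≡ suc a₁ → k 2 ≡ suc a₂ →
  (∀ ℓ → Submultiset 2 n ℓ → HExistsWins 2 k ℓ →
     suc (c₁ * a₁ + c₂ * a₂) ≤ c₁ * prefixSum ℓ 1 + c₂ * prefixSum ℓ 2) →
  IsWeightedMajority 2 n (HExistsWins 2 k)
prefixWeights₂⇒weighted n k c₁ c₂ a₁ a₂ k₁≡ k₂≡ win =
  ℕ-weights⇒weighted 2 n k w (suc t)
    (λ ℓ ℓ⊆n wins → subst (suc t ≤_) (sym (value ℓ)) (win ℓ ℓ⊆n wins))
    (λ ℓ _ L → subst (_< suc t) (sym (value ℓ)) (s≤s (combination-mono c₁ c₂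
       (≤-pred (subst (prefixSum ℓ 1 <_) k₁≡ (L 1 ≤-refl (s≤s z≤n))))
       (≤-pred (subst (prefixSum ℓ 2 <_) k₂≡ (L 2 (s≤s z≤n) ≤-refl))))))
  where
  t = c₁ * a₁ + c₂ * a₂
  w : ℕ → ℕ
  w 1 = c₁ + c₂
  w _ = c₂
  value : ∀ ℓ → weightedSumℕ 2 ℓ w ≡ c₁ * prefixSum ℓ 1 + c₂ * prefixSum ℓ 2
  value ℓ = identity (ℓ 1) (ℓ 2) c₁ c₂
    where
    identity : ∀ x y c₁ c₂ → 0 + x * (c₁ + c₂) + y * c₂ ≡ c₁ * (0 + x) + c₂ * (0 + x + y)
    identity = solve-∀

k₂≡k₁+1⇒weighted : ∀ n k → 1 ≤ k 1 → k 2 ≡ k 1 + 1 → IsWeightedMajority 2 n (HExistsWins 2 k)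
k₂≡k₁+1⇒weighted n k k₁≥1 k₂≡ with a , k₁≡ ← ≤⇒∃+ k₁≥1 =
  prefixWeights₂⇒weighted n k 1 (suc a) a (a + 1) k₁≡ k₂≡′ win
  where
  open ≤-Reasoning
  k₂≡′ : k 2 ≡ suc (a + 1)
  k₂≡′ = trans k₂≡ (cong (_+ 1) k₁≡)
  win : ∀ ℓ → Submultiset 2 n ℓ → HExistsWins 2 k ℓ →
    suc (1 * a + suc a * (a + 1)) ≤ 1 * prefixSum ℓ 1 + suc a * prefixSum ℓ 2
  win ℓ _ wins with wins₂-cases wins
  ... | inj₁ k₁≤P₁ = begin
    suc (1 * a + suc a * (a + 1))  ≡⟨ identity a ⟩
    1 * suc a + suc a * suc a      ≤⟨ combination-mono 1 (suc a) a<P₁ (≤-trans a<P₁ (m≤m+n _ (ℓ 2))) ⟩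
    1 * prefixSum ℓ 1 + suc a * prefixSum ℓ 2 ∎
    where
    a<P₁ = subst (_≤ prefixSum ℓ 1) k₁≡ k₁≤P₁
    identity : ∀ a → suc (1 * a + suc a * (a + 1)) ≡ 1 * suc a + suc a * suc a
    identity = solve-∀
  ... | inj₂ k₂≤P₂ = begin
    suc (1 * a + suc a * (a + 1))  ≡⟨ identity a ⟩
    1 * 0 + suc a * suc (a + 1)    ≤⟨ combination-mono 1 (suc a) (z≤n {prefixSum ℓ 1}) (subst (_≤ prefixSum ℓ 2) k₂≡′ k₂≤P₂) ⟩
    1 * prefixSum ℓ 1 + suc a * prefixSum ℓ 2 ∎
    where
    identity : ∀ a → suc (1 * a + suc a * (a + 1)) ≡ 1 * 0 + suc a * suc (a + 1)
    identity = solve-∀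

n₂≡k₂∸k₁+1⇒weighted : ∀ n k → 1 ≤ k 1 → k 1 < k 2 → n 2 ≡ (k 2 ∸ k 1) + 1 →
  IsWeightedMajority 2 n (HExistsWins 2 k)
n₂≡k₂∸k₁+1⇒weighted n k k₁≥1 k₁<k₂ n₂≡ with a , k₁≡ ← ≤⇒∃+ k₁≥1 | d , k₂≡ ← <⇒∃+suc k₁<k₂ =
  prefixWeights₂⇒weighted n k (suc d) 1 a (a + suc d) k₁≡ k₂≡′ win
  where
  open ≤-Reasoning
  k₂≡′ : k 2 ≡ suc (a + suc d)
  k₂≡′ = trans k₂≡ (cong (_+ suc d) k₁≡)
  win : ∀ ℓ → Submultiset 2 n ℓ → HExistsWins 2 k ℓ →
    suc (suc d * a + 1 * (a + suc d)) ≤ suc d * prefixSum ℓ 1 + 1 * prefixSum ℓ 2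
  win ℓ ℓ⊆n wins with wins₂-cases wins
  ... | inj₁ k₁≤P₁ = begin
    suc (suc d * a + 1 * (a + suc d))  ≡⟨ identity a d ⟩
    suc d * suc a + 1 * suc a          ≤⟨ combination-mono (suc d) 1 a<P₁ (≤-trans a<P₁ (m≤m+n _ (ℓ 2))) ⟩
    suc d * prefixSum ℓ 1 + 1 * prefixSum ℓ 2 ∎
    where
    a<P₁ = subst (_≤ prefixSum ℓ 1) k₁≡ k₁≤P₁
    identity : ∀ a d → suc (suc d * a + 1 * (a + suc d)) ≡ suc d * suc a + 1 * suc a
    identity = solve-∀
  ... | inj₂ k₂≤P₂ = begin
    suc (suc d * a + 1 * (a + suc d))  ≡⟨ identity a d ⟩
    suc d * a + 1 * suc (a + suc d)    ≤⟨ combination-mono (suc d) 1 a≤P₁ (subst (_≤ prefixSum ℓ 2) k₂≡′ k₂≤P₂) ⟩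
    suc d * prefixSum ℓ 1 + 1 * prefixSum ℓ 2 ∎
    where
    identity : ∀ a d → suc (suc d * a + 1 * (a + suc d)) ≡ suc d * a + 1 * suc (a + suc d)
    identity = solve-∀
    -- a coalition reaching k₂ holds at most n₂ = k₂ − k₁ + 1 players of level 2, hence k₁ − 1 of level 1
    a≤P₁ : a ≤ prefixSum ℓ 1
    a≤P₁ = +-cancelʳ-≤ (suc d + 1) a (prefixSum ℓ 1) (begin
      a + (suc d + 1)            ≡⟨ trans (+-suc a (d + 1)) (cong (λ x → suc (a + x)) (+-comm d 1)) ⟩
      suc (a + suc d)            ≡⟨ k₂≡′ ⟨
      k 2                        ≤⟨ k₂≤P₂ ⟩
      prefixSum ℓ 1 + ℓ 2        ≤⟨ +-monoʳ-≤ (prefixSum ℓ 1) (subst (ℓ 2 ≤_) n₂≡′ (ℓ⊆n 2 (s≤s z≤n) ≤-refl)) ⟩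
      prefixSum ℓ 1 + (suc d + 1) ∎)
      where
      n₂≡′ : n 2 ≡ suc d + 1
      n₂≡′ = trans n₂≡ (cong (_+ 1) (∸-of-+ (k 1) (suc d) k₂≡))

-- level i + 1 consists of dummies exactly when k i + n (suc i) ≤ k (suc i)
record WithoutDummies (m : ℕ) (n k : ℕ → ℕ) : Set where
  field
    k₁-positive : 1 ≤ k 1
    k₁≤n₁       : k 1 ≤ n 1
    increasing  : ∀ i → 1 ≤ i → i < m → k i < k (suc i)
    nonDummy    : ∀ i → 1 ≤ i → i < m → k (suc i) < k i + n (suc i)

  step : ∀ i → 1 ≤ i → i < m → ∃ λ d → k (suc i) ≡ k i + suc d × 2 + d ≤ n (suc i)
  step i 1≤i i<m = consecutive-gap (increasing i 1≤i i<m) (nonDummy i 1≤i i<m)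

trade-twoLevels : ∀ n k b → 2 ≤ k 1 → k 1 ≤ n 1 → k 2 ≡ k 1 + suc (suc b) → 4 + b ≤ n 2 → Trade 2 n k
trade-twoLevels n k b k₁≥2 k₁≤n₁ k₂≡ n₂≥ with a , k₁≡ ← ≤⇒∃+ k₁≥2 = record
  { A        = profile (2 + a ∷ 0 ∷ [])
  ; B        = profile (a ∷ 4 + b ∷ [])
  ; C        = profile (1 + a ∷ 2 ∷ [])
  ; D        = profile (1 + a ∷ 2 + b ∷ [])
  ; A⊆n      = ⊆U (≤-refl ∷ z≤n ∷ [])
  ; B⊆n      = ⊆U (m≤n+m a 2 ∷ ≤-refl ∷ [])
  ; C⊆n      = ⊆U (n≤1+n _ ∷ s≤s (s≤s z≤n) ∷ [])
  ; D⊆n      = ⊆U (n≤1+n _ ∷ m≤n+m (2 + b) 2 ∷ [])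
  ; A-wins   = 1 , ≤-refl , s≤s z≤n , ≤-reflexive k₁≡
  ; B-wins   = 2 , s≤s z≤n , ≤-refl , ≤-reflexive (trans k₂≡′ (identity a b))
  ; C-loses  = D-loses ∘ wins-mono 2 k (profile-⊆ (≤-refl ∷ m≤m+n 2 b ∷ []))
  ; D-loses  = D-loses
  ; balanced = levels₂ (cong suc (sym (+-suc a a))) refl
  }
  where
  k₂≡′ : k 2 ≡ (2 + a) + (2 + b)
  k₂≡′ = trans k₂≡ (cong (_+ (2 + b)) k₁≡)
  ⊆U : ∀ {xs} → Pointwise _≤_ xs (2 + a ∷ 4 + b ∷ []) → Submultiset 2 n (profile xs)
  ⊆U = Submultiset-trans (levels₂ (subst (_≤ n 1) k₁≡ k₁≤n₁) n₂≥) ∘ profile-⊆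
  D-loses : ¬ HExistsWins 2 k (profile (1 + a ∷ 2 + b ∷ []))
  D-loses = losing⇒¬wins (levels₂ (≤-reflexive (sym k₁≡)) (≤-reflexive (sym k₂≡′)))
  identity : ∀ a b → (2 + a) + (2 + b) ≡ a + (4 + b)
  identity = solve-∀

trade-threeLevels : ∀ n k → WithoutDummies 3 n k → 2 ≤ k 1 → Trade 3 n k
trade-threeLevels n k wd k₁≥2
  with a , k₁≡ ← ≤⇒∃+ k₁≥2
     | b , k₂≡ , n₂≥ ← WithoutDummies.step wd 1 ≤-refl (s≤s (s≤s z≤n))
     | c , k₃≡ , n₃≥ ← WithoutDummies.step wd 2 (s≤s z≤n) ≤-refl = record
  { A        = profile (2 + a ∷ 0 ∷ 0 ∷ [])
  ; B        = profile (a ∷ 2 + b ∷ 2 + c ∷ [])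
  ; C        = profile (1 + a ∷ 1 ∷ 1 ∷ [])
  ; D        = profile (1 + a ∷ 1 + b ∷ 1 + c ∷ [])
  ; A⊆n      = ⊆U (≤-refl ∷ z≤n ∷ z≤n ∷ [])
  ; B⊆n      = ⊆U (m≤n+m a 2 ∷ ≤-refl ∷ ≤-refl ∷ [])
  ; C⊆n      = ⊆U (n≤1+n _ ∷ s≤s z≤n ∷ s≤s z≤n ∷ [])
  ; D⊆n      = ⊆U (n≤1+n _ ∷ n≤1+n _ ∷ n≤1+n _ ∷ [])
  ; A-wins   = 1 , ≤-refl , s≤s z≤n , ≤-reflexive k₁≡
  ; B-wins   = 3 , s≤s z≤n , ≤-refl , ≤-reflexive (trans k₃≡′ (identity a b c))
  ; C-loses  = D-loses ∘ wins-mono 3 k (profile-⊆ (≤-refl ∷ s≤s z≤n ∷ s≤s z≤n ∷ []))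
  ; D-loses  = D-loses
  ; balanced = levels₃ (cong suc (sym (+-suc a a))) refl refl
  }
  where
  k₂≡′ : k 2 ≡ (2 + a) + suc b
  k₂≡′ = trans k₂≡ (cong (_+ suc b) k₁≡)
  k₃≡′ : k 3 ≡ ((2 + a) + suc b) + suc c
  k₃≡′ = trans k₃≡ (cong (_+ suc c) k₂≡′)
  ⊆U : ∀ {xs} → Pointwise _≤_ xs (2 + a ∷ 2 + b ∷ 2 + c ∷ []) → Submultiset 3 n (profile xs)
  ⊆U = Submultiset-trans (levels₃ (subst (_≤ n 1) k₁≡ (WithoutDummies.k₁≤n₁ wd)) n₂≥ n₃≥) ∘ profile-⊆
  D-loses : ¬ HExistsWins 3 k (profile (1 + a ∷ 1 + b ∷ 1 + c ∷ []))
  D-loses = losing⇒¬wins (levels₃ (≤-reflexive (sym k₁≡)) (≤-reflexive (sym k₂≡′)) (≤-reflexive (sym k₃≡′)))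
  identity : ∀ a b c → ((2 + a) + suc b) + suc c ≡ (a + (2 + b)) + (2 + c)
  identity = solve-∀

Cond1-3 : ℕ → (ℕ → ℕ) → (ℕ → ℕ) → Set
Cond1-3 m n k =
  (m ≡ 1) ⊎
  (m ≡ 2 × k 2 ≡ k 1 + 1) ⊎
  (m ≡ 2 × n 2 ≡ (k 2 ∸ k 1) + 1)

Cond1-3⇒Cond1-4 : ∀ {m n k} → Cond1-3 m n k → Cond1-4 m n k
Cond1-3⇒Cond1-4 (inj₁ c)        = inj₁ c
Cond1-3⇒Cond1-4 (inj₂ (inj₁ c)) = inj₂ (inj₁ c)
Cond1-3⇒Cond1-4 (inj₂ (inj₂ c)) = inj₂ (inj₂ (inj₁ c))

tail-Cond1-3⇒Cond1-4 : ∀ {m n k} → k 1 ≡ 1 → Cond1-3 m (n ∘ suc) (k ∘ suc) → Cond1-4 (suc m) n k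
tail-Cond1-3⇒Cond1-4 k₁≡1 (inj₁ refl)              = inj₂ (inj₂ (inj₂ (k₁≡1 , inj₁ refl)))
tail-Cond1-3⇒Cond1-4 k₁≡1 (inj₂ (inj₁ (refl , c))) = inj₂ (inj₂ (inj₂ (k₁≡1 , inj₂ (refl , inj₁ c))))
tail-Cond1-3⇒Cond1-4 k₁≡1 (inj₂ (inj₂ (refl , c))) = inj₂ (inj₂ (inj₂ (k₁≡1 , inj₂ (refl , inj₂ c))))

Cond1-3⇒≤2 : ∀ {m n k} → Cond1-3 m n k → m ≤ 2
Cond1-3⇒≤2 (inj₁ refl)              = s≤s z≤n
Cond1-3⇒≤2 (inj₂ (inj₁ (refl , _))) = ≤-refl
Cond1-3⇒≤2 (inj₂ (inj₂ (refl , _))) = ≤-refl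

Cond1-4⇒≤3 : ∀ {m n k} → Cond1-4 m n k → m ≤ 3
Cond1-4⇒≤3 (inj₁ refl)                                = s≤s z≤n
Cond1-4⇒≤3 (inj₂ (inj₁ (refl , _)))                   = s≤s (s≤s z≤n)
Cond1-4⇒≤3 (inj₂ (inj₂ (inj₁ (refl , _))))            = s≤s (s≤s z≤n)
Cond1-4⇒≤3 (inj₂ (inj₂ (inj₂ (_ , inj₁ refl))))       = s≤s (s≤s z≤n)
Cond1-4⇒≤3 (inj₂ (inj₂ (inj₂ (_ , inj₂ (refl , _))))) = ≤-refl

WithoutDummies-init : ∀ {m n k} → WithoutDummies (suc m) n k → WithoutDummies m n k
WithoutDummies-init wd = record
  { k₁-positive = k₁-positive
  ; k₁≤n₁       = k₁≤n₁
  ; increasing  = λ i 1≤i i<m → increasing i 1≤i (m<n⇒m<1+n i<m)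
  ; nonDummy    = λ i 1≤i i<m → nonDummy i 1≤i (m<n⇒m<1+n i<m)
  }
  where open WithoutDummies wd

WithoutDummies-tail : ∀ {m n k} → 1 ≤ m → k 1 ≡ 1 → WithoutDummies (suc m) n k →
  WithoutDummies m (n ∘ suc) (k ∘ suc)
WithoutDummies-tail {n = n} {k} 1≤m k₁≡1 wd = record
  { k₁-positive = ≤-trans k₁-positive (<⇒≤ (increasing 1 ≤-refl (s≤s 1≤m)))
  ; k₁≤n₁       = ≤-pred (subst (λ x → k 2 < x + n 2) k₁≡1 (nonDummy 1 ≤-refl (s≤s 1≤m)))
  ; increasing  = λ i _ i<m → increasing (suc i) (s≤s z≤n) (s≤s i<m)
  ; nonDummy    = λ i _ i<m → nonDummy (suc i) (s≤s z≤n) (s≤s i<m)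
  }
  where open WithoutDummies wd

twoLevels-gap : ∀ {n k} → WithoutDummies 2 n k → k 2 ≢ k 1 + 1 → n 2 ≢ (k 2 ∸ k 1) + 1 →
  ∃ λ b → k 2 ≡ k 1 + suc (suc b) × 4 + b ≤ n 2
twoLevels-gap {n} {k} wd k₂≢ n₂≢ with WithoutDummies.step wd 1 ≤-refl ≤-refl
... | zero  , k₂≡ , _   = ⊥-elim (k₂≢ k₂≡)
... | suc b , k₂≡ , n₂≥ = b , k₂≡ , ≤∧≢⇒< n₂≥ λ e → n₂≢ (trans (sym e)
        (sym (trans (cong (_+ 1) (∸-of-+ (k 1) (suc (suc b)) k₂≡)) (+-comm (2 + b) 1))))

weighted⇒Cond1-3 : ∀ m n k → 1 ≤ m → WithoutDummies m n k → 2 ≤ k 1 →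
  IsWeightedMajority m n (HExistsWins m k) → Cond1-3 m n k
weighted⇒Cond1-3 1 n k _ _ _ _ = inj₁ refl
weighted⇒Cond1-3 2 n k _ wd k₁≥2 wm with k 2 ≟ k 1 + 1 | n 2 ≟ (k 2 ∸ k 1) + 1
... | yes k₂≡ | _       = inj₂ (inj₁ (refl , k₂≡))
... | no _    | yes n₂≡ = inj₂ (inj₂ (refl , n₂≡))
... | no k₂≢  | no n₂≢  = let b , k₂≡ , n₂≥ = twoLevels-gap wd k₂≢ n₂≢ in
  ⊥-elim (trade⇒¬weighted (trade-twoLevels n k b k₁≥2 (WithoutDummies.k₁≤n₁ wd) k₂≡ n₂≥) wm)
weighted⇒Cond1-3 3 n k _ wd k₁≥2 wm = ⊥-elim (trade⇒¬weighted (trade-threeLevels n k wd k₁≥2) wm)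
weighted⇒Cond1-3 (suc m@(suc (suc (suc _)))) n k _ wd k₁≥2 wm =
  ⊥-elim (<⇒≱ (s≤s (s≤s (s≤s z≤n))) (Cond1-3⇒≤2 {n = n} {k} (weighted⇒Cond1-3 m n k (s≤s z≤n)
    (WithoutDummies-init wd) k₁≥2
    (weighted⇒init-weighted m n k (s≤s z≤n) (<⇒≤ (WithoutDummies.increasing wd m (s≤s z≤n) ≤-refl)) wm))))

weighted⇒Cond1-4 : ∀ m n k → 1 ≤ m → WithoutDummies m n k →
  IsWeightedMajority m n (HExistsWins m k) → Cond1-4 m n k
weighted⇒Cond1-4 1 n k _ _ _ = inj₁ refl
weighted⇒Cond1-4 (suc (suc m)) n k _ wd wm with k 1 ≟ 1
... | no k₁≢1 = Cond1-3⇒Cond1-4 {n = n} {k} (weighted⇒Cond1-3 (suc (suc m)) n k (s≤s z≤n) wd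
      (≤∧≢⇒< (WithoutDummies.k₁-positive wd) (k₁≢1 ∘ sym)) wm)
... | yes k₁≡1 = tail-Cond1-3⇒Cond1-4 {n = n} {k} k₁≡1 (weighted⇒Cond1-3 (suc m) (n ∘ suc) (k ∘ suc)
      (s≤s z≤n) (WithoutDummies-tail (s≤s z≤n) k₁≡1 wd)
      (subst (_< k 2) k₁≡1 (WithoutDummies.increasing wd 1 ≤-refl (s≤s (s≤s z≤n))))
      (weighted⇒tail-weighted (suc m) n k (WithoutDummies.k₁-positive wd) wm))

Cond1-3⇒weighted : ∀ m n k → 1 ≤ k 1 → (2 ≤ m → k 1 < k 2) → Cond1-3 m n k →
  IsWeightedMajority m n (HExistsWins m k)
Cond1-3⇒weighted m n k _    _     (inj₁ refl)               = weighted-oneLevel n k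
Cond1-3⇒weighted m n k k₁≥1 _     (inj₂ (inj₁ (refl , k₂≡))) = k₂≡k₁+1⇒weighted n k k₁≥1 k₂≡
Cond1-3⇒weighted m n k k₁≥1 k₁<k₂ (inj₂ (inj₂ (refl , n₂≡))) = n₂≡k₂∸k₁+1⇒weighted n k k₁≥1 (k₁<k₂ ≤-refl) n₂≡

Cond1-4⇒weighted : ∀ m n k → 1 ≤ k 1 → (∀ i → 1 ≤ i → i < m → k i < k (suc i)) → Cond1-4 m n k →
  IsWeightedMajority m n (HExistsWins m k)
Cond1-4⇒weighted m n k k₁≥1 incr (inj₁ c) =
  Cond1-3⇒weighted m n k k₁≥1 (incr 1 ≤-refl) (inj₁ c)
Cond1-4⇒weighted m n k k₁≥1 incr (inj₂ (inj₁ c)) =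
  Cond1-3⇒weighted m n k k₁≥1 (incr 1 ≤-refl) (inj₂ (inj₁ c))
Cond1-4⇒weighted m n k k₁≥1 incr (inj₂ (inj₂ (inj₁ c))) =
  Cond1-3⇒weighted m n k k₁≥1 (incr 1 ≤-refl) (inj₂ (inj₂ c))
Cond1-4⇒weighted m n k k₁≥1 incr (inj₂ (inj₂ (inj₂ (k₁≡1 , inj₁ refl)))) =
  tail-weighted⇒weighted 1 n k k₁≡1 (weighted-oneLevel (n ∘ suc) (k ∘ suc))
Cond1-4⇒weighted m n k k₁≥1 incr (inj₂ (inj₂ (inj₂ (k₁≡1 , inj₂ (refl , c))))) =
  tail-weighted⇒weighted 2 n k k₁≡1 (Cond1-3⇒weighted 2 (n ∘ suc) (k ∘ suc)
    (≤-trans k₁≥1 (<⇒≤ (incr 1 ≤-refl (s≤s (s≤s z≤n))))) (λ _ → incr 2 (s≤s z≤n) ≤-refl)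
    (inj₂ (Sum.map (refl ,_) (refl ,_) c)))

admissible⇒withoutDummies : ∀ {m n k} j → Admissible m n k → j ≤ m → (2 ≤ j → k j < k (j ∸ 1) + n j) →
  WithoutDummies j n k
admissible⇒withoutDummies {n = n} {k} j (1≤m , _ , k-pos , k-incr , k₁≤n₁ , k-mid , _) j≤m top = record
  { k₁-positive = k-pos 1 ≤-refl 1≤m
  ; k₁≤n₁       = k₁≤n₁
  ; increasing  = λ i 1≤i i<j → k-incr i 1≤i (<-≤-trans i<j j≤m)
  ; nonDummy    = nonDummy
  }
  where
  nonDummy : ∀ i → 1 ≤ i → i < j → k (suc i) < k i + n (suc i)
  nonDummy i 1≤i i<j with m≤n⇒m<n∨m≡n i<j
  ... | inj₁ 1+i<j = k-mid (suc i) (s≤s 1≤i) (<-≤-trans 1+i<j j≤m)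
  ... | inj₂ 1+i≡j = subst (λ x → k x < k (x ∸ 1) + n x) (sym 1+i≡j) (top (subst (2 ≤_) 1+i≡j (s≤s 1≤i)))

2+m≡2⊎3⊎4 : ∀ {m} → m ≤ 2 → 2 + m ≡ 2 ⊎ 2 + m ≡ 3 ⊎ 2 + m ≡ 4
2+m≡2⊎3⊎4 z≤n             = inj₁ refl
2+m≡2⊎3⊎4 (s≤s z≤n)       = inj₂ (inj₁ refl)
2+m≡2⊎3⊎4 (s≤s (s≤s z≤n)) = inj₂ (inj₂ refl)

2⊎3⊎4⇒2≤ : ∀ {m} → m ≡ 2 ⊎ m ≡ 3 ⊎ m ≡ 4 → 2 ≤ m
2⊎3⊎4⇒2≤ (inj₁ refl)        = s≤s (s≤s z≤n)
2⊎3⊎4⇒2≤ (inj₂ (inj₁ refl)) = s≤s (s≤s z≤n)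
2⊎3⊎4⇒2≤ (inj₂ (inj₂ refl)) = s≤s (s≤s z≤n)

weighted⇒Cond1-5 : ∀ m n k → Admissible m n k → IsWeightedMajority m n (HExistsWins m k) → Cond1-5 m n k
weighted⇒Cond1-5 zero          n k (() , _) _
weighted⇒Cond1-5 1             n k _ _ = inj₁ (inj₁ refl)
weighted⇒Cond1-5 (suc (suc m)) n k adm@(_ , _ , _ , k-incr , _ , k-mid , _) wm
  with k (suc m) + n (suc (suc m)) ≤? k (suc (suc m))
... | no top-nonDummy = inj₁ (weighted⇒Cond1-4 (suc (suc m)) n k (s≤s z≤n)
      (admissible⇒withoutDummies (suc (suc m)) adm ≤-refl (λ _ → ≰⇒> top-nonDummy)) wm)
... | yes top-dummy = inj₂ (2+m≡2⊎3⊎4 (≤-pred (Cond1-4⇒≤3 {n = n} {k} c)) , top-dummy , c)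
  where
  c : Cond1-4 (suc m) n k
  c = weighted⇒Cond1-4 (suc m) n k (s≤s z≤n)
        (admissible⇒withoutDummies (suc m) adm (n≤1+n _) (λ 2≤ → k-mid (suc m) 2≤ ≤-refl))
        (weighted⇒init-weighted (suc m) n k (s≤s z≤n) (<⇒≤ (k-incr (suc m) (s≤s z≤n) ≤-refl)) wm)

Cond1-5⇒weighted : ∀ m n k → Admissible m n k → Cond1-5 m n k → IsWeightedMajority m n (HExistsWins m k)
Cond1-5⇒weighted m n k (1≤m , _ , k-pos , k-incr , _) (inj₁ c) =
  Cond1-4⇒weighted m n k (k-pos 1 ≤-refl 1≤m) k-incr c
Cond1-5⇒weighted zero n k (() , _) (inj₂ _)
Cond1-5⇒weighted (suc m) n k (_ , _ , k-pos , k-incr , _) (inj₂ (levels , top-dummy , c)) =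
  init-weighted⇒weighted m n k 1≤m top-dummy (Cond1-4⇒weighted m n k (k-pos 1 ≤-refl (m≤n⇒m≤1+n 1≤m))
    (λ i 1≤i i<m → k-incr i 1≤i (m<n⇒m<1+n i<m)) c)
  where
  1≤m : 1 ≤ m
  1≤m = ≤-pred (2⊎3⊎4⇒2≤ levels)

theorem7 : (m : ℕ) → (n k : ℕ → ℕ) → Admissible m n k →
           (IsWeightedMajority m n (HExistsWins m k) ⇔ Cond1-5 m n k)
theorem7 m n k adm = mk⇔ (weighted⇒Cond1-5 m n k adm) (Cond1-5⇒weighted m n k adm)
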